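{- There are no semi-finite generalized hexagons of order $(2,t)$ containing $H^D(2)$ as a full subgeometry.
   Context: A generalized hexagon is a partial linear space whose collinearity graph is connected of diameter $3$, such that every point $x$ and line $L$ have a unique point on $L$ nearest to $x$, every point is on at least two lines, and any two points at distance $2$ have a unique common neighbour. A semi-finite generalized hexagon of order $(2,t)$ has three points on each line and infinitely many lines through each point. A subgeometry is full if every point incident with one of its lines belongs to it. $H^D(2)$ is the point-line dual of the split Cayley hexagon $H(2)$ of order $2$. -}

module Defs where

open import Level using (Level; _⊔_; suc)
open import Data.Bool using (Bool; true; false; _∧_; _∨_; _xor_; not; T)
open import Data.Nat using (ℕ; zero; _<_; _<ᵇ_; _+_; _*_) renaming (suc to sucℕ)
open import Data.Fin using (Fin) renaming (zero to f0; suc to fs)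
open import Data.Vec using (Vec; []; _∷_; zipWith; lookup; foldr)
open import Data.Product using (Σ; ∃; ∃-syntax; _×_; _,_)
open import Data.Sum using (_⊎_)
open import Relation.Binary.PropositionalEquality using (_≡_)
open import Relation.Nullary using (¬_)
open import Function.Definitions using (Injective)

record Geometry (ℓ : Level) : Set (Level.suc ℓ) where
  field
    Point : Set ℓ
    Line  : Set ℓ
    _I_   : Point → Line → Set ℓ

module GeometryNotions {ℓ} (S : Geometry ℓ) where
  open Geometry S

  Adj : Point → Point → Set ℓ
  Adj x y = ¬ (x ≡ y) × (∃[ L ] (x I L × y I L))

  data Walk : ℕ → Point → Point → Set ℓ where
    stay : ∀ {x} → Walk 0 x x
    step : ∀ {k x y z} → Adj x y → Walk k y z → Walk (sucℕ k) x z

  Dist : Point → Point → ℕ → Set ℓ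
  Dist x y k = Walk k x y × (∀ j → j < k → ¬ Walk j x y)

  Within : ℕ → Point → Point → Set ℓ
  Within n x y = ∃[ k ] (k Data.Nat.≤ n × Walk k x y)

  IsPartialLinearSpace : Set ℓ
  IsPartialLinearSpace =
    (∀ L → ∃[ x ] ∃[ y ] (¬ (x ≡ y) × x I L × y I L)) ×
    (∀ x y L M → ¬ (x ≡ y) → x I L → y I L → x I M → y I M → L ≡ M)

  IsGeneralizedHexagon : Set ℓ
  IsGeneralizedHexagon =
    IsPartialLinearSpace ×
    (∀ x y → Within 3 x y) ×
    (∃[ x ] ∃[ y ] Dist x y 3) ×
    (∀ x L → ∃[ p ] (p I L × ∃[ k ] (Dist x p k ×
        (∀ q → q I L → ¬ (q ≡ p) → ∃[ m ] (Dist x q m × k < m))))) ×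
    (∀ x → ∃[ L ] ∃[ M ] (¬ (L ≡ M) × x I L × x I M)) ×
    (∀ x y → Dist x y 2 → ∃[ z ] (Adj x z × Adj z y ×
        (∀ w → Adj x w → Adj w y → w ≡ z)))

  ThreePointsPerLine : Set ℓ
  ThreePointsPerLine = ∀ L → ∃[ a ] ∃[ b ] ∃[ c ]
    (a I L × b I L × c I L × ¬ (a ≡ b) × ¬ (a ≡ c) × ¬ (b ≡ c) ×
     (∀ p → p I L → (p ≡ a) ⊎ (p ≡ b) ⊎ (p ≡ c)))

  InfinitelyManyLinesThroughEachPoint : Set ℓ
  InfinitelyManyLinesThroughEachPoint = ∀ x n →
    ∃[ f ] (Injective _≡_ _≡_ f × ((i : Fin n) → x I f i))

  IsSemiFiniteHexagonOrder2t : Set ℓ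
  IsSemiFiniteHexagonOrder2t =
    IsGeneralizedHexagon × ThreePointsPerLine × InfinitelyManyLinesThroughEachPoint

-- A full subgeometry of S isomorphic to T: injective maps on points and
-- lines such that incidence is preserved and reflected (the image is a
-- subgeometry with induced incidence isomorphic to T), and fullness: every
-- point of S on an image line is an image point.
record FullEmbedding {ℓ ℓ'} (T : Geometry ℓ') (S : Geometry ℓ) : Set (ℓ ⊔ ℓ') where
  module T = Geometry T
  module S = Geometry S
  field
    pt      : T.Point → S.Point
    ln      : T.Line → S.Line
    pt-inj  : Injective _≡_ _≡_ pt
    ln-inj  : Injective _≡_ _≡_ ln
    inc-pres : ∀ p L → p T.I L → pt p S.I ln L
    inc-refl : ∀ p L → pt p S.I ln L → p T.I L
    full    : ∀ L x → x S.I ln L → ∃[ p ] (pt p ≡ x)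

-- The split Cayley hexagon H(2) (Tits' coordinates; Van Maldeghem,
-- Generalized Polygons, 2.4.13), specialised to GF(2) = Bool.
-- Points: points of Q(6,2): X0X4 + X1X5 + X2X6 = X3² in PG(6,2)
-- (a projective point over GF(2) = a nonzero vector).
-- Lines: lines of Q(6,2) whose Grassmann coordinates satisfy
--   p12 = p34, p54 = p32, p20 = p35, p65 = p30, p01 = p36, p46 = p31.

V7 : Set
V7 = Vec Bool 7

_⊕_ : V7 → V7 → V7
_⊕_ = zipWith _xor_

nonzero : V7 → Bool
nonzero = foldr (λ _ → Bool) _∨_ false

eqB : Bool → Bool → Bool
eqB a b = not (a xor b)

eqV : ∀ {n} → Vec Bool n → Vec Bool n → Bool
eqV [] [] = true
eqV (a ∷ u) (b ∷ v) = eqB a b ∧ eqV u v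

quadForm : V7 → Bool
quadForm (x0 ∷ x1 ∷ x2 ∷ x3 ∷ x4 ∷ x5 ∷ x6 ∷ []) =
  ((x0 ∧ x4) xor (x1 ∧ x5)) xor ((x2 ∧ x6) xor x3)

onQ : V7 → Bool
onQ v = nonzero v ∧ not (quadForm v)

-- binary value of a vector (x0 most significant), used to choose a
-- canonical representative pair for each line
val : ∀ {n} → Vec Bool n → ℕ
val {n} = go 0
  where
  go : ∀ {m} → ℕ → Vec Bool m → ℕ
  go acc [] = acc
  go acc (b ∷ v) = go (2 * acc + (if b then 1 else 0)) v
    where open import Data.Bool using (if_then_else_)

pc : V7 → V7 → Fin 7 → Fin 7 → Bool
pc x y i j = (lookup x i ∧ lookup y j) xor (lookup x j ∧ lookup y i)

i0 i1 i2 i3 i4 i5 i6 : Fin 7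
i0 = f0
i1 = fs f0
i2 = fs (fs f0)
i3 = fs (fs (fs f0))
i4 = fs (fs (fs (fs f0)))
i5 = fs (fs (fs (fs (fs f0))))
i6 = fs (fs (fs (fs (fs (fs f0)))))

titsCond : V7 → V7 → Bool
titsCond x y =
  eqB (pc x y i1 i2) (pc x y i3 i4) ∧
  eqB (pc x y i5 i4) (pc x y i3 i2) ∧
  eqB (pc x y i2 i0) (pc x y i3 i5) ∧
  eqB (pc x y i6 i5) (pc x y i3 i0) ∧
  eqB (pc x y i0 i1) (pc x y i3 i6) ∧
  eqB (pc x y i4 i6) (pc x y i3 i1)

-- (x , y) is the canonical pair of an H(2)-line {x, y, x+y}:
-- all three on Q(6,2) (so distinct and nonzero once ordered strictly),
-- val x < val y < val (x+y), and Tits' condition holds.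
isH2Line : V7 → V7 → Bool
isH2Line x y =
  onQ x ∧ onQ y ∧ onQ (x ⊕ y) ∧
  (val x <ᵇ val y) ∧ (val y <ᵇ val (x ⊕ y)) ∧ titsCond x y

H2Point : Set
H2Point = Σ V7 (λ v → T (onQ v))

H2Line : Set
H2Line = Σ (V7 × V7) (λ { (x , y) → T (isH2Line x y) })

H2Inc : H2Point → H2Line → Set
H2Inc (v , _) ((x , y) , _) = T (eqV v x ∨ eqV v y ∨ eqV v (x ⊕ y))

H2 : Geometry Level.zero
H2 = record { Point = H2Point ; Line = H2Line ; _I_ = H2Inc }

HD2 : Geometry Level.zero
HD2 = record { Point = H2Line ; Line = H2Point ; _I_ = λ L p → H2Inc p L }

-- Let S contain H^D(2) fully.  If a point w of S had distance at least 2 from every point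
-- of H^D(2), then on each line of H^D(2) the point of S nearest to w would be at distance
-- exactly 2 and be the only such point; so the points at distance 2 from w would form a
-- distance-2 ovoid of H^D(2), and an exhaustive case split shows that there is none.
-- Hence every point of S is within distance 1 of H^D(2).  A point x outside H^D(2) lies on
-- more lines than H^D(2) has points, so two of its lines carry points w ≠ x ≠ w′ within
-- distance 1 of the same point g ≠ x of H^D(2): a closed path x w g w′ of length at most 4
-- not contained in a line, impossible in a generalized hexagon.  So S is H^D(2), which is
-- finite, contradicting the infinitely many lines through each point.
-- Equality of points of S is not decidable, so the case distinctions are made under a
-- double negation, which is harmless since the goal is ⊥.
module Submission where

open import Defs
open import Level using (_⊔_)
open import Data.Bool using (Bool; T)
open import Data.Bool.Properties as Bool using (T?; T-irrelevant)
open import Data.Empty using (⊥; ⊥-elim)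
open import Data.Fin as Fin using (Fin; zero; suc; funToFin; finToFun)
open import Data.Fin.Properties using (pigeonhole; <⇒≢; finToFun-funToFin; 2↔Bool)
open import Data.List using (List; []; _∷_)
import Data.List.Membership.DecPropositional as DecMembership
open import Data.List.Relation.Unary.All as All using (All; []; _∷_)
open import Data.Nat using (ℕ; zero; suc; _≤_; _<_; z≤n; s≤s; _^_; _/_; _%_; _≡ᵇ_)
open import Data.Nat.Properties using (n<1+n; ≤-antisym; ≤-pred; ≤-trans; <⇒≱; ≮⇒≥)
open import Data.Product using (∃; ∃₂; ∃-syntax; _×_; _,_; proj₁; proj₂)
import Data.Product.Properties as Product
open import Data.Sum as Sum using (_⊎_; inj₁; inj₂)
open import Data.Vec using (Vec; []; _∷_; _∷ʳ_; _++_; lookup; tabulate)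
open import Data.Vec.Properties as Vec using (tabulate∘lookup; tabulate-cong; ++-injective)
open import Function using (_∘_)
open import Function.Bundles using (Injection; _↣_; mk↣)
open import Function.Construct.Composition using (_↣-∘_)
open import Function.Properties.Inverse using (↔-sym; ↔⇒↣)
open import Relation.Binary.Definitions using (DecidableEquality)
open import Relation.Binary.PropositionalEquality
  using (_≡_; _≢_; refl; sym; trans; cong; subst; module ≡-Reasoning)
open import Relation.Nullary using (¬_; Dec; _×-dec_; ¬?)
open import Relation.Nullary.Decidable using (yes; no; map′; toWitness; ¬¬-excluded-middle)
open import Relation.Nullary.Negation using (¬¬-map)

¬¬-Π : ∀ {a} n {P : Fin n → Set a} → (∀ i → ¬ ¬ P i) → ¬ ¬ (∀ i → P i)
¬¬-Π zero _ k = k (λ ())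
¬¬-Π (suc n) h k = h zero λ p₀ → ¬¬-Π n (h ∘ suc) λ ps → k λ { zero → p₀ ; (suc i) → ps i }

¬¬-pigeonhole : ∀ {a r n} {A : Set a} → A ↣ Fin n → (R : Fin (suc n) → A → Set r) →
  (∀ i → ¬ ¬ ∃ (R i)) → ¬ ¬ ∃₂ λ i j → i ≢ j × ∃ λ x → R i x × R j x
¬¬-pigeonhole {n = n} code R labelled k = ¬¬-Π (suc n) labelled λ label →
  let (i , j , i<j , same) = pigeonhole (n<1+n n) (to ∘ proj₁ ∘ label)
      (x , Rix) = label i
      (y , Rjy) = label j
  in k (i , j , <⇒≢ i<j , x , Rix , subst (R j) (sym (injective same)) Rjy)
  where open Injection code using (to; injective)

-- A set O of points meeting every line exactly once.  Both halves are double negated,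
-- since O is an arbitrary predicate; "meets" is only demanded for three-point lines.
record IsDistance2Ovoid {ℓ a} (G : Geometry ℓ) (O : Geometry.Point G → Set a) : Set (ℓ ⊔ a) where
  open Geometry G
  field
    meets : ∀ {L x y z} → x I L → y I L → z I L → x ≢ y → x ≢ z → y ≢ z → ¬ ¬ (O x ⊎ O y ⊎ O z)
    meets-at-most-once : ∀ {L x y} → x I L → y I L → O x → O y → ¬ ¬ (x ≡ y)

module Distance2OvoidRefutation {ℓ} (G : Geometry ℓ)
  (_≟_ : DecidableEquality (Geometry.Point G))
  (_I?_ : ∀ x L → Dec (Geometry._I_ G x L)) where
  open Geometry G
  open DecMembership _≟_ using (_∈_; _∈?_)

  -- A case split refuting all distance-2 ovoids: split L x y z branches on which of the
  -- points x, y, z of L lies in the ovoid, and clash L x y closes a branch in which two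
  -- points x, y already chosen lie on L.  The list `chosen` holds the branch's choices.
  data Refutation : Set ℓ where
    clash : Line → Point → Point → Refutation
    split : Line → Point → Point → Point → Refutation → Refutation → Refutation → Refutation

  Valid : List Point → Refutation → Set ℓ
  Valid chosen (clash L x y) = x I L × y I L × x ≢ y × x ∈ chosen × y ∈ chosen
  Valid chosen (split L x y z r s t) =
    x I L × y I L × z I L × x ≢ y × x ≢ z × y ≢ z ×
    Valid (x ∷ chosen) r × Valid (y ∷ chosen) s × Valid (z ∷ chosen) t

  valid? : ∀ chosen r → Dec (Valid chosen r)
  valid? chosen (clash L x y) =
    (x I? L) ×-dec (y I? L) ×-dec ¬? (x ≟ y) ×-dec (x ∈? chosen) ×-dec (y ∈? chosen)
  valid? chosen (split L x y z r s t) =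
    (x I? L) ×-dec (y I? L) ×-dec (z I? L) ×-dec ¬? (x ≟ y) ×-dec ¬? (x ≟ z) ×-dec ¬? (y ≟ z) ×-dec
    valid? (x ∷ chosen) r ×-dec valid? (y ∷ chosen) s ×-dec valid? (z ∷ chosen) t

  Valid⇒¬Distance2Ovoid : ∀ {a} {O : Point → Set a} → IsDistance2Ovoid G O →
    ∀ {chosen} r → Valid chosen r → All O chosen → ⊥
  Valid⇒¬Distance2Ovoid ovoid (clash L x y) (xL , yL , x≢y , x∈ , y∈) Os =
    meets-at-most-once xL yL (All.lookup Os x∈) (All.lookup Os y∈) x≢y
    where open IsDistance2Ovoid ovoid
  Valid⇒¬Distance2Ovoid ovoid (split L x y z r s t) (xL , yL , zL , x≢y , x≢z , y≢z , vr , vs , vt) Os =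
    meets xL yL zL x≢y x≢z y≢z λ
      { (inj₁ Ox) → Valid⇒¬Distance2Ovoid ovoid r vr (Ox ∷ Os)
      ; (inj₂ (inj₁ Oy)) → Valid⇒¬Distance2Ovoid ovoid s vs (Oy ∷ Os)
      ; (inj₂ (inj₂ Oz)) → Valid⇒¬Distance2Ovoid ovoid t vt (Oz ∷ Os) }
    where open IsDistance2Ovoid ovoid

module WalkProperties {ℓ} (S : Geometry ℓ) where
  open Geometry S
  open GeometryNotions S

  Near : Point → Point → Set ℓ
  Near x y = x ≡ y ⊎ Adj x y

  Adj-sym : ∀ {x y} → Adj x y → Adj y x
  Adj-sym (x≢y , L , xL , yL) = x≢y ∘ sym , L , yL , xL

  Walk₀⇒≡ : ∀ {x y} → Walk 0 x y → x ≡ y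
  Walk₀⇒≡ stay = refl

  Walk₁⇒Adj : ∀ {x y} → Walk 1 x y → Adj x y
  Walk₁⇒Adj (step xy stay) = xy

  Adj⇒Dist₁ : ∀ {x y} → Adj x y → Dist x y 1
  Adj⇒Dist₁ xy = step xy stay , λ { zero _ w → proj₁ xy (Walk₀⇒≡ w) ; (suc _) (s≤s ()) _ }

  Dist₂ : ∀ {x y z} → x ≢ z → ¬ Adj x z → Adj x y → Adj y z → Dist x z 2
  Dist₂ x≢z ¬xz xy yz = step xy (step yz stay) , shorter
    where
    shorter : ∀ j → j < 2 → ¬ Walk j _ _
    shorter zero _ w = x≢z (Walk₀⇒≡ w)
    shorter (suc zero) _ w = ¬xz (Walk₁⇒Adj w)
    shorter (suc (suc _)) (s≤s (s≤s ())) _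

  Dist-functional : ∀ {x y k m} → Dist x y k → Dist x y m → k ≡ m
  Dist-functional (wk , shortestk) (wm , shortestm) =
    ≤-antisym (≮⇒≥ λ m<k → shortestk _ m<k wm) (≮⇒≥ λ k<m → shortestm _ k<m wk)

  Dist≤ : ∀ {x y n m} → Dist x y m → Within n x y → m ≤ n
  Dist≤ (_ , shortest) (_ , j≤n , w) = ≤-trans (≮⇒≥ λ j<m → shortest _ j<m w) j≤n

module GeneralizedHexagonProperties {ℓ} {S : Geometry ℓ}
  (hexagon : GeometryNotions.IsGeneralizedHexagon S) where
  open Geometry S
  open GeometryNotions S
  open WalkProperties S

  private
    partialLinear : IsPartialLinearSpace
    partialLinear = proj₁ hexagon
    diameter : ∀ x y → Within 3 x y
    diameter = proj₁ (proj₂ hexagon)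

  line-unique : ∀ {x y L M} → x ≢ y → x I L → y I L → x I M → y I M → L ≡ M
  line-unique = proj₂ partialLinear _ _ _ _

  ¬¬-otherPoint : ∀ L y → ¬ ¬ (∃[ q ] (q I L × q ≢ y))
  ¬¬-otherPoint L y ¬other with proj₁ partialLinear L
  ... | a , b , a≢b , aL , bL = ¬other (a , aL , λ a≡y → ¬other (b , bL , λ b≡y → a≢b (trans a≡y (sym b≡y))))

  nearestPoint : ∀ x L → ∃[ p ] (p I L × ∃[ k ] (Dist x p k ×
    (∀ q → q I L → q ≢ p → ∃[ m ] (Dist x q m × k < m))))
  nearestPoint = proj₁ (proj₂ (proj₂ (proj₂ hexagon)))

  commonNeighbour-unique : ∀ {x y w w′} → Dist x y 2 →
    Adj x w → Adj w y → Adj x w′ → Adj w′ y → w ≡ w′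
  commonNeighbour-unique {x} {y} d xw wy xw′ w′y with proj₂ (proj₂ (proj₂ (proj₂ (proj₂ hexagon)))) x y d
  ... | z , _ , _ , unique = trans (unique _ xw wy) (sym (unique _ xw′ w′y))

  somePoint : Point
  somePoint = proj₁ (proj₁ (proj₂ (proj₂ hexagon)))

  Dist≤3 : ∀ {x y m} → Dist x y m → m ≤ 3
  Dist≤3 {x} {y} d = Dist≤ d (diameter x y)

  minimal-distance-unique : ∀ {x L m q q′} → (∀ {r k} → r I L → Dist x r k → m ≤ k) →
    q I L → Dist x q m → q′ I L → Dist x q′ m → ¬ ¬ (q ≡ q′)
  minimal-distance-unique {x} {L} {m} minimal qL dq q′L dq′ q≢q′
    with nearestPoint x L
  ... | p , pL , k , dp , further =
    is-p qL dq λ q≡p → is-p q′L dq′ λ q′≡p → q≢q′ (trans q≡p (sym q′≡p))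
    where
    is-p : ∀ {r} → r I L → Dist x r m → ¬ ¬ (r ≡ p)
    is-p rL dr r≢p with further _ rL r≢p
    ... | m′ , dr′ , k<m′ = <⇒≱ (subst (k <_) (Dist-functional dr′ dr) k<m′) (minimal pL dp)

  ¬¬-nearbyPoint : ∀ x L → ¬ ¬ (∃[ p ] (p I L × ∃[ k ] (Dist x p k × k ≤ 2)))
  ¬¬-nearbyPoint x L ¬nearby with nearestPoint x L
  ... | p , pL , k , dp , further = ¬¬-otherPoint L p λ (q , qL , q≢p) →
    let (m , dq , k<m) = further q qL q≢p
    in ¬nearby (p , pL , k , dp , ≤-pred (≤-trans k<m (Dist≤3 dq)))

  Adj-Adj⇒I : ∀ {x y z L} → x I L → y I L → x ≢ y → Adj z x → Adj z y → ¬ ¬ (z I L)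
  Adj-Adj⇒I {x} {y} {z} {L} xL yL x≢y zx zy z∉L =
    minimal-distance-unique off-line xL (Adj⇒Dist₁ zx) yL (Adj⇒Dist₁ zy) x≢y
    where
    off-line : ∀ {r k} → r I L → Dist z r k → 1 ≤ k
    off-line {k = zero} rL (w , _) = ⊥-elim (z∉L (subst (_I L) (sym (Walk₀⇒≡ w)) rL))
    off-line {k = suc _} _ _ = s≤s z≤n

  Spoke : Point → Line → Point → Set ℓ
  Spoke x L w = x I L × w I L × w ≢ x

  Spoke⇒Adj : ∀ {x L w} → Spoke x L w → Adj x w
  Spoke⇒Adj (xL , wL , w≢x) = w≢x ∘ sym , _ , xL , wL

  Spoke-Adj⇒I : ∀ {x L w u} → Spoke x L w → Adj u x → Adj u w → ¬ ¬ (u I L)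
  Spoke-Adj⇒I (xL , wL , w≢x) = Adj-Adj⇒I xL wL (w≢x ∘ sym)

  distinct-lines-meet-once : ∀ {x u L M} → L ≢ M → x I L → x I M → u ≢ x → u I L → u I M → ⊥
  distinct-lines-meet-once L≢M xL xM u≢x uL uM = L≢M (line-unique u≢x uL xL uM xM)

  no-short-cycle : ∀ {x L M w w′ g} → L ≢ M → Spoke x L w → Spoke x M w′ → g ≢ x →
    Near w g → Near w′ g → ⊥
  no-short-cycle L≢M (xL , wL , w≢x) (xM , w′M , _) _ (inj₁ refl) (inj₁ refl) =
    distinct-lines-meet-once L≢M xL xM w≢x wL w′M
  no-short-cycle L≢M sL@(xL , _ , _) sM@(xM , w′M , w′≢x) _ (inj₁ refl) (inj₂ w′w) =
    Spoke-Adj⇒I sL (Adj-sym (Spoke⇒Adj sM)) w′w λ w′L →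
    distinct-lines-meet-once L≢M xL xM w′≢x w′L w′M
  no-short-cycle L≢M sL sM g≢x (inj₂ wg) (inj₁ refl) =
    no-short-cycle (L≢M ∘ sym) sM sL g≢x (inj₁ refl) (inj₂ wg)
  no-short-cycle L≢M sL@(xL , wL , w≢x) sM@(xM , w′M , _) g≢x (inj₂ wg) (inj₂ w′g) =
    ¬¬-excluded-middle λ
      { (yes xg) →
          Spoke-Adj⇒I sL (Adj-sym xg) (Adj-sym wg) λ gL →
          Spoke-Adj⇒I sM (Adj-sym xg) (Adj-sym w′g) λ gM →
          distinct-lines-meet-once L≢M xL xM g≢x gL gM
      ; (no ¬xg) →
          let xw = Spoke⇒Adj sL
              w≡w′ = commonNeighbour-unique (Dist₂ (g≢x ∘ sym) ¬xg xw wg) xw wg (Spoke⇒Adj sM) w′g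
          in distinct-lines-meet-once L≢M xL xM w≢x wL (subst (_I _) (sym w≡w′) w′M) }

  module _ (infinite : InfinitelyManyLinesThroughEachPoint) {a n} {A : Set a} (code : A ↣ Fin n) where

    pigeonhole-on-lines : ∀ {p} (P : Point → A → Set p) → (∀ w → ¬ ¬ ∃ (P w)) → ∀ x →
      ¬ (∀ {L M w w′ h} → L ≢ M → Spoke x L w → Spoke x M w′ → P w h → P w′ h → ⊥)
    pigeonhole-on-lines P labelled x separated =
      ¬¬-pigeonhole code (λ i h → ∃[ w ] (Spoke x (lines i) w × P w h)) labelledSpoke
        λ (i , j , i≢j , h , (w , sw , Pw) , (w′ , sw′ , Pw′)) →
        separated (i≢j ∘ lines-injective) sw sw′ Pw Pw′
      where
      lines : Fin (suc n) → Line
      lines = proj₁ (infinite x (suc n))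
      lines-injective : ∀ {i j} → lines i ≡ lines j → i ≡ j
      lines-injective = proj₁ (proj₂ (infinite x (suc n)))
      through : ∀ i → x I lines i
      through = proj₂ (proj₂ (infinite x (suc n)))
      labelledSpoke : ∀ i → ¬ ¬ (∃[ h ] ∃[ w ] (Spoke x (lines i) w × P w h))
      labelledSpoke i ¬labelled = ¬¬-otherPoint (lines i) x λ (w , wL , w≢x) →
        labelled w λ (h , Pwh) → ¬labelled (h , w , (through i , wL , w≢x) , Pwh)

    near-image⇒image : (f : A → Point) → (∀ w → ¬ ¬ (∃[ h ] Near w (f h))) →
      ∀ x → ¬ ¬ (∃[ h ] f h ≡ x)
    near-image⇒image f near x x∉image = pigeonhole-on-lines (λ w h → Near w (f h)) near x
      λ L≢M sL sM → no-short-cycle L≢M sL sM (λ fh≡x → x∉image (_ , fh≡x))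

    ¬image-covers : (f : A → Point) → ¬ (∀ x → ¬ ¬ (∃[ h ] f h ≡ x))
    ¬image-covers f covers = pigeonhole-on-lines (λ w h → f h ≡ w) covers somePoint
      λ { L≢M (xL , wL , w≢x) (xM , w′M , _) refl refl → distinct-lines-meet-once L≢M xL xM w≢x wL w′M }

module ThreePointLineProperties {ℓ} {S : Geometry ℓ}
  (three : GeometryNotions.ThreePointsPerLine S) where
  open Geometry S

  ¬fourPoints : ∀ {L} (v : Fin 4 → Point) → (∀ i → v i I L) → (∀ {i j} → i Fin.< j → v i ≢ v j) → ⊥
  ¬fourPoints {L} v vL distinct with three L
  ... | a , b , c , _ , _ , _ , _ , _ , _ , onLine =
    let (i , j , i<j , same) = pigeonhole (n<1+n 3) (proj₁ ∘ position)
    in distinct i<j (trans (proj₂ (position i)) (trans (cong abc same) (sym (proj₂ (position j)))))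
    where
    abc : Fin 3 → Point
    abc = lookup (a ∷ b ∷ c ∷ [])
    slot : ∀ {p} → p ≡ a ⊎ p ≡ b ⊎ p ≡ c → ∃[ s ] (p ≡ abc s)
    slot (inj₁ p≡a) = zero , p≡a
    slot (inj₂ (inj₁ p≡b)) = suc zero , p≡b
    slot (inj₂ (inj₂ p≡c)) = suc (suc zero) , p≡c
    position : ∀ i → ∃[ s ] (v i ≡ abc s)
    position i = slot (onLine (v i) (vL i))

  oneOfThree : ∀ {L a b c p} → a I L → b I L → c I L → a ≢ b → a ≢ c → b ≢ c → p I L →
    ¬ ¬ (p ≡ a ⊎ p ≡ b ⊎ p ≡ c)
  oneOfThree {L} {a} {b} {c} {p} aL bL cL a≢b a≢c b≢c pL ¬one = ¬fourPoints abcp onL distinct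
    where
    abcp : Fin 4 → Point
    abcp = lookup (a ∷ b ∷ c ∷ p ∷ [])
    onL : ∀ i → abcp i I L
    onL zero = aL
    onL (suc zero) = bL
    onL (suc (suc zero)) = cL
    onL (suc (suc (suc zero))) = pL
    distinct : ∀ {i j} → i Fin.< j → abcp i ≢ abcp j
    distinct {zero} {suc zero} _ = a≢b
    distinct {zero} {suc (suc zero)} _ = a≢c
    distinct {zero} {suc (suc (suc zero))} _ a≡p = ¬one (inj₁ (sym a≡p))
    distinct {suc zero} {suc (suc zero)} _ = b≢c
    distinct {suc zero} {suc (suc (suc zero))} _ b≡p = ¬one (inj₂ (inj₁ (sym b≡p)))
    distinct {suc (suc zero)} {suc (suc (suc zero))} _ c≡p = ¬one (inj₂ (inj₂ (sym c≡p)))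
    distinct {_} {zero} ()
    distinct {suc _} {suc zero} (s≤s ())
    distinct {suc (suc _)} {suc (suc zero)} (s≤s (s≤s ()))
    distinct {suc (suc (suc _))} {suc (suc (suc zero))} (s≤s (s≤s (s≤s ())))

module FullEmbeddingProperties {ℓ ℓ′} {G : Geometry ℓ′} {S : Geometry ℓ}
  (hexagon : GeometryNotions.IsGeneralizedHexagon S)
  (three : GeometryNotions.ThreePointsPerLine S) (E : FullEmbedding G S) where
  module G = Geometry G
  open Geometry S
  open GeometryNotions S
  open WalkProperties S
  open GeneralizedHexagonProperties hexagon
  open ThreePointLineProperties three
  open FullEmbedding E using (pt; ln; pt-inj; inc-pres; full)

  far⇒distance2Ovoid : ∀ {w} → ¬ (∃[ h ] Near w (pt h)) → IsDistance2Ovoid G (λ h → Dist w (pt h) 2)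
  far⇒distance2Ovoid {w} far = record { meets = meets ; meets-at-most-once = meets-at-most-once }
    where
    far-from-image-lines : ∀ {l r k} → r I ln l → Dist w r k → 2 ≤ k
    far-from-image-lines {l} {r} {zero} rl (walk , _) with full l r rl
    ... | h , refl = ⊥-elim (far (h , inj₁ (Walk₀⇒≡ walk)))
    far-from-image-lines {l} {r} {suc zero} rl (walk , _) with full l r rl
    ... | h , refl = ⊥-elim (far (h , inj₂ (Walk₁⇒Adj walk)))
    far-from-image-lines {k = suc (suc _)} _ _ = s≤s (s≤s z≤n)

    ¬¬-pointAtDistance₂ : ∀ l → ¬ ¬ (∃[ p ] (p I ln l × Dist w p 2))
    ¬¬-pointAtDistance₂ l ¬p = ¬¬-nearbyPoint w (ln l) λ (p , pl , k , dp , k≤2) →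
      ¬p (p , pl , subst (Dist w p) (≤-antisym k≤2 (far-from-image-lines pl dp)) dp)

    meets : ∀ {l x y z} → x G.I l → y G.I l → z G.I l → x ≢ y → x ≢ z → y ≢ z →
      ¬ ¬ (Dist w (pt x) 2 ⊎ Dist w (pt y) 2 ⊎ Dist w (pt z) 2)
    meets {l} {x} {y} {z} xl yl zl x≢y x≢z y≢z ¬meets = ¬¬-pointAtDistance₂ l λ (p , pl , dp) →
      oneOfThree (inc-pres x l xl) (inc-pres y l yl) (inc-pres z l zl)
        (x≢y ∘ pt-inj) (x≢z ∘ pt-inj) (y≢z ∘ pt-inj) pl
        (¬meets ∘ Sum.map (at dp) (Sum.map (at dp) (at dp)))
      where
      at : ∀ {p q} → Dist w p 2 → p ≡ q → Dist w q 2
      at dp refl = dp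

    meets-at-most-once : ∀ {l x y} → x G.I l → y G.I l → Dist w (pt x) 2 → Dist w (pt y) 2 → ¬ ¬ (x ≡ y)
    meets-at-most-once {l} {x} {y} xl yl dx dy =
      ¬¬-map pt-inj (minimal-distance-unique far-from-image-lines (inc-pres x l xl) dx (inc-pres y l yl) dy)

Vec-Bool↣Fin : ∀ n → Vec Bool n ↣ Fin (2 ^ n)
Vec-Bool↣Fin n = mk↣ {to = encode} encode-injective
  where
  open Injection (↔⇒↣ (↔-sym 2↔Bool)) using () renaming (to to bit; injective to bit-injective)
  encode : Vec Bool n → Fin (2 ^ n)
  encode v = funToFin (bit ∘ lookup v)
  encode-injective : ∀ {u v} → encode u ≡ encode v → u ≡ v
  encode-injective {u} {v} eq = begin
    u                   ≡⟨ tabulate∘lookup u ⟨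
    tabulate (lookup u) ≡⟨ tabulate-cong same-bits ⟩
    tabulate (lookup v) ≡⟨ tabulate∘lookup v ⟩
    v                   ∎
    where
    open ≡-Reasoning
    same-bits : ∀ i → lookup u i ≡ lookup v i
    same-bits i = bit-injective (begin
      bit (lookup u i)            ≡⟨ finToFun-funToFin (bit ∘ lookup u) i ⟨
      finToFun (encode u) i       ≡⟨ cong (λ c → finToFun c i) eq ⟩
      finToFun (encode v) i       ≡⟨ finToFun-funToFin (bit ∘ lookup v) i ⟩
      bit (lookup v i)            ∎)

H2Line↣Vec : H2Line ↣ Vec Bool 14
H2Line↣Vec = mk↣ {to = coordinates} injective
  where
  coordinates : H2Line → Vec Bool 14
  coordinates ((x , y) , _) = x ++ y
  injective : ∀ {l m} → coordinates l ≡ coordinates m → l ≡ m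
  injective {(x , y) , p} {(x′ , y′) , q} eq with ++-injective x x′ eq
  ... | refl , refl = cong ((x , y) ,_) (T-irrelevant p q)

H2Line↣Fin : H2Line ↣ Fin (2 ^ 14)
H2Line↣Fin = Vec-Bool↣Fin 14 ↣-∘ H2Line↣Vec

-- Points and lines of H(2) are named by the binary values (as in val) of their
-- coordinate vectors; the proofs that they lie in H(2) are implicit and found by evaluation.
bits : (k : ℕ) → ℕ → Vec Bool k
bits zero _ = []
bits (suc k) n = bits k (n / 2) ∷ʳ (n % 2 ≡ᵇ 1)

H2pt : (n : ℕ) {_ : T (onQ (bits 7 n))} → H2Point
H2pt n {on} = bits 7 n , on

H2ln : (m n : ℕ) {_ : T (isH2Line (bits 7 m) (bits 7 n))} → H2Line
H2ln m n {is} = (bits 7 m , bits 7 n) , is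

_≟ᴸ_ : DecidableEquality H2Line
(u , p) ≟ᴸ (v , q) =
  map′ (λ { refl → cong (u ,_) (T-irrelevant p q) }) (cong proj₁) (Product.≡-dec _≟ⱽ_ _≟ⱽ_ u v)
  where
  _≟ⱽ_ : DecidableEquality (Vec Bool 7)
  _≟ⱽ_ = Vec.≡-dec Bool._≟_

H2Inc? : ∀ x l → Dec (Geometry._I_ HD2 x l)
H2Inc? _ (_ , _) = T? _

open Distance2OvoidRefutation HD2 _≟ᴸ_ H2Inc?

certificate : Refutation
certificate =
  split (H2pt 1) (H2ln 1 32) (H2ln 1 64) (H2ln 1 96)
    (split (H2pt 4) (H2ln 4 16) (H2ln 4 32) (H2ln 4 48)
      (split (H2pt 2) (H2ln 2 16) (H2ln 2 64) (H2ln 2 80)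
        (clash (H2pt 16) (H2ln 4 16) (H2ln 2 16))
        (split (H2pt 3) (H2ln 3 48) (H2ln 3 64) (H2ln 3 112)
          (split (H2pt 76) (H2ln 18 76) (H2ln 33 76) (H2ln 51 76)
            (split (H2pt 5) (H2ln 5 32) (H2ln 5 80) (H2ln 5 112)
              (clash (H2pt 32) (H2ln 1 32) (H2ln 5 32))
              (split (H2pt 7) (H2ln 7 48) (H2ln 7 80) (H2ln 7 96)
                (clash (H2pt 48) (H2ln 3 48) (H2ln 7 48))
                (clash (H2pt 80) (H2ln 5 80) (H2ln 7 80))
                (split (H2pt 6) (H2ln 6 16) (H2ln 6 96) (H2ln 6 112)
                  (clash (H2pt 16) (H2ln 4 16) (H2ln 6 16))
                  (clash (H2pt 96) (H2ln 7 96) (H2ln 6 96))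
                  (split (H2pt 27) (H2ln 27 47) (H2ln 27 66) (H2ln 27 109)
                    (split (H2pt 42) (H2ln 20 42) (H2ln 42 65) (H2ln 42 85)
                      (clash (H2pt 20) (H2ln 4 16) (H2ln 20 42))
                      (split (H2pt 43) (H2ln 31 43) (H2ln 43 65) (H2ln 43 94)
                        (clash (H2pt 52) (H2ln 27 47) (H2ln 31 43))
                        (clash (H2pt 65) (H2ln 42 65) (H2ln 43 65))
                        (clash (H2pt 94) (H2ln 18 76) (H2ln 43 94)))
                      (clash (H2pt 85) (H2ln 5 80) (H2ln 42 85)))
                    (clash (H2pt 66) (H2ln 2 64) (H2ln 27 66))
                    (clash (H2pt 118) (H2ln 6 112) (H2ln 27 109)))))
              (split (H2pt 6) (H2ln 6 16) (H2ln 6 96) (H2ln 6 112)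
                (clash (H2pt 16) (H2ln 4 16) (H2ln 6 16))
                (split (H2pt 7) (H2ln 7 48) (H2ln 7 80) (H2ln 7 96)
                  (clash (H2pt 48) (H2ln 3 48) (H2ln 7 48))
                  (split (H2pt 25) (H2ln 25 36) (H2ln 25 66) (H2ln 25 102)
                    (split (H2pt 46) (H2ln 20 46) (H2ln 46 79) (H2ln 46 91)
                      (clash (H2pt 20) (H2ln 4 16) (H2ln 20 46))
                      (split (H2pt 78) (H2ln 18 78) (H2ln 47 78) (H2ln 61 78)
                        (clash (H2pt 18) (H2ln 18 76) (H2ln 18 78))
                        (clash (H2pt 97) (H2ln 46 79) (H2ln 47 78))
                        (clash (H2pt 61) (H2ln 25 36) (H2ln 61 78)))
                      (clash (H2pt 117) (H2ln 5 112) (H2ln 46 91)))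
                    (clash (H2pt 66) (H2ln 2 64) (H2ln 25 66))
                    (clash (H2pt 102) (H2ln 6 96) (H2ln 25 102)))
                  (clash (H2pt 96) (H2ln 6 96) (H2ln 7 96)))
                (clash (H2pt 112) (H2ln 5 112) (H2ln 6 112))))
            (clash (H2pt 33) (H2ln 1 32) (H2ln 33 76))
            (clash (H2pt 51) (H2ln 3 48) (H2ln 51 76)))
          (clash (H2pt 64) (H2ln 2 64) (H2ln 3 64))
          (split (H2pt 5) (H2ln 5 32) (H2ln 5 80) (H2ln 5 112)
            (clash (H2pt 32) (H2ln 1 32) (H2ln 5 32))
            (split (H2pt 6) (H2ln 6 16) (H2ln 6 96) (H2ln 6 112)
              (clash (H2pt 16) (H2ln 4 16) (H2ln 6 16))
              (split (H2pt 7) (H2ln 7 48) (H2ln 7 80) (H2ln 7 96)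
                (split (H2pt 25) (H2ln 25 36) (H2ln 25 66) (H2ln 25 102)
                  (split (H2pt 42) (H2ln 20 42) (H2ln 42 65) (H2ln 42 85)
                    (clash (H2pt 20) (H2ln 4 16) (H2ln 20 42))
                    (split (H2pt 29) (H2ln 29 36) (H2ln 29 79) (H2ln 29 107)
                      (clash (H2pt 36) (H2ln 25 36) (H2ln 29 36))
                      (split (H2pt 77) (H2ln 31 77) (H2ln 33 77) (H2ln 62 77)
                        (clash (H2pt 82) (H2ln 29 79) (H2ln 31 77))
                        (clash (H2pt 33) (H2ln 1 32) (H2ln 33 77))
                        (clash (H2pt 115) (H2ln 3 112) (H2ln 62 77)))
                      (clash (H2pt 107) (H2ln 42 65) (H2ln 29 107)))
                    (clash (H2pt 85) (H2ln 5 80) (H2ln 42 85)))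
                  (clash (H2pt 66) (H2ln 2 64) (H2ln 25 66))
                  (clash (H2pt 102) (H2ln 6 96) (H2ln 25 102)))
                (clash (H2pt 80) (H2ln 5 80) (H2ln 7 80))
                (clash (H2pt 96) (H2ln 6 96) (H2ln 7 96)))
              (clash (H2pt 112) (H2ln 3 112) (H2ln 6 112)))
            (clash (H2pt 112) (H2ln 3 112) (H2ln 5 112))))
        (split (H2pt 5) (H2ln 5 32) (H2ln 5 80) (H2ln 5 112)
          (clash (H2pt 32) (H2ln 1 32) (H2ln 5 32))
          (clash (H2pt 80) (H2ln 2 80) (H2ln 5 80))
          (split (H2pt 6) (H2ln 6 16) (H2ln 6 96) (H2ln 6 112)
            (clash (H2pt 16) (H2ln 4 16) (H2ln 6 16))
            (split (H2pt 7) (H2ln 7 48) (H2ln 7 80) (H2ln 7 96)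
              (split (H2pt 3) (H2ln 3 48) (H2ln 3 64) (H2ln 3 112)
                (clash (H2pt 48) (H2ln 7 48) (H2ln 3 48))
                (split (H2pt 31) (H2ln 31 43) (H2ln 31 77) (H2ln 31 102)
                  (split (H2pt 46) (H2ln 20 46) (H2ln 46 79) (H2ln 46 91)
                    (clash (H2pt 20) (H2ln 4 16) (H2ln 20 46))
                    (split (H2pt 47) (H2ln 27 47) (H2ln 47 78) (H2ln 47 85)
                      (clash (H2pt 52) (H2ln 31 43) (H2ln 27 47))
                      (clash (H2pt 97) (H2ln 46 79) (H2ln 47 78))
                      (split (H2pt 108) (H2ln 22 108) (H2ln 33 77) (H2ln 55 91)
                        (clash (H2pt 122) (H2ln 47 85) (H2ln 22 108))
                        (clash (H2pt 33) (H2ln 1 32) (H2ln 33 77))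
                        (clash (H2pt 55) (H2ln 7 48) (H2ln 55 91))))
                    (clash (H2pt 117) (H2ln 5 112) (H2ln 46 91)))
                  (clash (H2pt 82) (H2ln 2 80) (H2ln 31 77))
                  (clash (H2pt 102) (H2ln 6 96) (H2ln 31 102)))
                (clash (H2pt 112) (H2ln 5 112) (H2ln 3 112)))
              (clash (H2pt 80) (H2ln 2 80) (H2ln 7 80))
              (clash (H2pt 96) (H2ln 6 96) (H2ln 7 96)))
            (clash (H2pt 112) (H2ln 5 112) (H2ln 6 112)))))
      (clash (H2pt 32) (H2ln 1 32) (H2ln 4 32))
      (split (H2pt 3) (H2ln 3 48) (H2ln 3 64) (H2ln 3 112)
        (clash (H2pt 48) (H2ln 4 48) (H2ln 3 48))
        (split (H2pt 2) (H2ln 2 16) (H2ln 2 64) (H2ln 2 80)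
          (split (H2pt 76) (H2ln 18 76) (H2ln 33 76) (H2ln 51 76)
            (clash (H2pt 18) (H2ln 2 16) (H2ln 18 76))
            (clash (H2pt 33) (H2ln 1 32) (H2ln 33 76))
            (split (H2pt 5) (H2ln 5 32) (H2ln 5 80) (H2ln 5 112)
              (clash (H2pt 32) (H2ln 1 32) (H2ln 5 32))
              (split (H2pt 7) (H2ln 7 48) (H2ln 7 80) (H2ln 7 96)
                (clash (H2pt 48) (H2ln 4 48) (H2ln 7 48))
                (clash (H2pt 80) (H2ln 5 80) (H2ln 7 80))
                (split (H2pt 6) (H2ln 6 16) (H2ln 6 96) (H2ln 6 112)
                  (clash (H2pt 16) (H2ln 2 16) (H2ln 6 16))
                  (clash (H2pt 96) (H2ln 7 96) (H2ln 6 96))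
                  (split (H2pt 27) (H2ln 27 47) (H2ln 27 66) (H2ln 27 109)
                    (clash (H2pt 52) (H2ln 4 48) (H2ln 27 47))
                    (split (H2pt 25) (H2ln 25 36) (H2ln 25 66) (H2ln 25 102)
                      (split (H2pt 57) (H2ln 29 36) (H2ln 57 67) (H2ln 57 94)
                        (clash (H2pt 36) (H2ln 25 36) (H2ln 29 36))
                        (clash (H2pt 67) (H2ln 3 64) (H2ln 57 67))
                        (clash (H2pt 103) (H2ln 7 96) (H2ln 57 94)))
                      (clash (H2pt 66) (H2ln 27 66) (H2ln 25 66))
                      (clash (H2pt 127) (H2ln 51 76) (H2ln 25 102)))
                    (clash (H2pt 118) (H2ln 6 112) (H2ln 27 109)))))
              (split (H2pt 6) (H2ln 6 16) (H2ln 6 96) (H2ln 6 112)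
                (clash (H2pt 16) (H2ln 2 16) (H2ln 6 16))
                (split (H2pt 7) (H2ln 7 48) (H2ln 7 80) (H2ln 7 96)
                  (clash (H2pt 48) (H2ln 4 48) (H2ln 7 48))
                  (split (H2pt 31) (H2ln 31 43) (H2ln 31 77) (H2ln 31 102)
                    (clash (H2pt 52) (H2ln 4 48) (H2ln 31 43))
                    (split (H2pt 43) (H2ln 31 43) (H2ln 43 65) (H2ln 43 94)
                      (clash (H2pt 31) (H2ln 31 77) (H2ln 31 43))
                      (split (H2pt 22) (H2ln 6 16) (H2ln 22 106) (H2ln 22 108)
                        (clash (H2pt 6) (H2ln 6 96) (H2ln 6 16))
                        (clash (H2pt 106) (H2ln 43 65) (H2ln 22 106))
                        (split (H2pt 85) (H2ln 5 80) (H2ln 42 85) (H2ln 47 85)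
                          (clash (H2pt 80) (H2ln 7 80) (H2ln 5 80))
                          (clash (H2pt 127) (H2ln 51 76) (H2ln 42 85))
                          (clash (H2pt 122) (H2ln 22 108) (H2ln 47 85))))
                      (clash (H2pt 117) (H2ln 5 112) (H2ln 43 94)))
                    (clash (H2pt 102) (H2ln 6 96) (H2ln 31 102)))
                  (clash (H2pt 96) (H2ln 6 96) (H2ln 7 96)))
                (clash (H2pt 112) (H2ln 5 112) (H2ln 6 112)))))
          (clash (H2pt 64) (H2ln 3 64) (H2ln 2 64))
          (split (H2pt 5) (H2ln 5 32) (H2ln 5 80) (H2ln 5 112)
            (clash (H2pt 32) (H2ln 1 32) (H2ln 5 32))
            (clash (H2pt 80) (H2ln 2 80) (H2ln 5 80))
            (split (H2pt 7) (H2ln 7 48) (H2ln 7 80) (H2ln 7 96)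
              (clash (H2pt 48) (H2ln 4 48) (H2ln 7 48))
              (clash (H2pt 80) (H2ln 2 80) (H2ln 7 80))
              (split (H2pt 6) (H2ln 6 16) (H2ln 6 96) (H2ln 6 112)
                (split (H2pt 31) (H2ln 31 43) (H2ln 31 77) (H2ln 31 102)
                  (clash (H2pt 52) (H2ln 4 48) (H2ln 31 43))
                  (clash (H2pt 82) (H2ln 2 80) (H2ln 31 77))
                  (split (H2pt 37) (H2ln 5 32) (H2ln 37 89) (H2ln 37 92)
                    (clash (H2pt 5) (H2ln 5 112) (H2ln 5 32))
                    (split (H2pt 27) (H2ln 27 47) (H2ln 27 66) (H2ln 27 109)
                      (clash (H2pt 52) (H2ln 4 48) (H2ln 27 47))
                      (clash (H2pt 89) (H2ln 37 89) (H2ln 27 66))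
                      (split (H2pt 29) (H2ln 29 36) (H2ln 29 79) (H2ln 29 107)
                        (split (H2pt 25) (H2ln 25 36) (H2ln 25 66) (H2ln 25 102)
                          (clash (H2pt 36) (H2ln 29 36) (H2ln 25 36))
                          (split (H2pt 108) (H2ln 22 108) (H2ln 33 77) (H2ln 55 91)
                            (clash (H2pt 22) (H2ln 6 16) (H2ln 22 108))
                            (clash (H2pt 33) (H2ln 1 32) (H2ln 33 77))
                            (clash (H2pt 91) (H2ln 25 66) (H2ln 55 91)))
                          (clash (H2pt 102) (H2ln 31 102) (H2ln 25 102)))
                        (clash (H2pt 82) (H2ln 2 80) (H2ln 29 79))
                        (clash (H2pt 118) (H2ln 27 109) (H2ln 29 107))))
                    (clash (H2pt 121) (H2ln 31 102) (H2ln 37 92))))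
                (clash (H2pt 96) (H2ln 7 96) (H2ln 6 96))
                (clash (H2pt 112) (H2ln 5 112) (H2ln 6 112))))))
        (split (H2pt 5) (H2ln 5 32) (H2ln 5 80) (H2ln 5 112)
          (clash (H2pt 32) (H2ln 1 32) (H2ln 5 32))
          (split (H2pt 7) (H2ln 7 48) (H2ln 7 80) (H2ln 7 96)
            (clash (H2pt 48) (H2ln 4 48) (H2ln 7 48))
            (clash (H2pt 80) (H2ln 5 80) (H2ln 7 80))
            (split (H2pt 6) (H2ln 6 16) (H2ln 6 96) (H2ln 6 112)
              (split (H2pt 2) (H2ln 2 16) (H2ln 2 64) (H2ln 2 80)
                (clash (H2pt 16) (H2ln 6 16) (H2ln 2 16))
                (split (H2pt 27) (H2ln 27 47) (H2ln 27 66) (H2ln 27 109)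
                  (clash (H2pt 52) (H2ln 4 48) (H2ln 27 47))
                  (clash (H2pt 66) (H2ln 2 64) (H2ln 27 66))
                  (split (H2pt 47) (H2ln 27 47) (H2ln 47 78) (H2ln 47 85)
                    (clash (H2pt 27) (H2ln 27 109) (H2ln 27 47))
                    (split (H2pt 18) (H2ln 2 16) (H2ln 18 76) (H2ln 18 78)
                      (clash (H2pt 2) (H2ln 2 64) (H2ln 2 16))
                      (split (H2pt 43) (H2ln 31 43) (H2ln 43 65) (H2ln 43 94)
                        (clash (H2pt 52) (H2ln 4 48) (H2ln 31 43))
                        (split (H2pt 87) (H2ln 7 80) (H2ln 58 87) (H2ln 61 87)
                          (clash (H2pt 7) (H2ln 7 96) (H2ln 7 80))
                          (clash (H2pt 109) (H2ln 27 109) (H2ln 58 87))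
                          (clash (H2pt 106) (H2ln 43 65) (H2ln 61 87)))
                        (clash (H2pt 94) (H2ln 18 76) (H2ln 43 94)))
                      (clash (H2pt 78) (H2ln 47 78) (H2ln 18 78)))
                    (clash (H2pt 85) (H2ln 5 80) (H2ln 47 85))))
                (clash (H2pt 80) (H2ln 5 80) (H2ln 2 80)))
              (clash (H2pt 96) (H2ln 7 96) (H2ln 6 96))
              (clash (H2pt 112) (H2ln 3 112) (H2ln 6 112))))
          (clash (H2pt 112) (H2ln 3 112) (H2ln 5 112)))))
    (split (H2pt 2) (H2ln 2 16) (H2ln 2 64) (H2ln 2 80)
      (split (H2pt 3) (H2ln 3 48) (H2ln 3 64) (H2ln 3 112)
        (split (H2pt 4) (H2ln 4 16) (H2ln 4 32) (H2ln 4 48)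
          (clash (H2pt 16) (H2ln 2 16) (H2ln 4 16))
          (split (H2pt 76) (H2ln 18 76) (H2ln 33 76) (H2ln 51 76)
            (clash (H2pt 18) (H2ln 2 16) (H2ln 18 76))
            (split (H2pt 5) (H2ln 5 32) (H2ln 5 80) (H2ln 5 112)
              (clash (H2pt 32) (H2ln 4 32) (H2ln 5 32))
              (split (H2pt 7) (H2ln 7 48) (H2ln 7 80) (H2ln 7 96)
                (clash (H2pt 48) (H2ln 3 48) (H2ln 7 48))
                (clash (H2pt 80) (H2ln 5 80) (H2ln 7 80))
                (split (H2pt 6) (H2ln 6 16) (H2ln 6 96) (H2ln 6 112)
                  (clash (H2pt 16) (H2ln 2 16) (H2ln 6 16))
                  (clash (H2pt 96) (H2ln 7 96) (H2ln 6 96))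
                  (split (H2pt 29) (H2ln 29 36) (H2ln 29 79) (H2ln 29 107)
                    (clash (H2pt 36) (H2ln 4 32) (H2ln 29 36))
                    (split (H2pt 42) (H2ln 20 42) (H2ln 42 65) (H2ln 42 85)
                      (split (H2pt 77) (H2ln 31 77) (H2ln 33 77) (H2ln 62 77)
                        (clash (H2pt 82) (H2ln 29 79) (H2ln 31 77))
                        (clash (H2pt 33) (H2ln 33 76) (H2ln 33 77))
                        (clash (H2pt 62) (H2ln 20 42) (H2ln 62 77)))
                      (clash (H2pt 65) (H2ln 1 64) (H2ln 42 65))
                      (clash (H2pt 85) (H2ln 5 80) (H2ln 42 85)))
                    (clash (H2pt 118) (H2ln 6 112) (H2ln 29 107)))))
              (split (H2pt 6) (H2ln 6 16) (H2ln 6 96) (H2ln 6 112)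
                (clash (H2pt 16) (H2ln 2 16) (H2ln 6 16))
                (split (H2pt 7) (H2ln 7 48) (H2ln 7 80) (H2ln 7 96)
                  (clash (H2pt 48) (H2ln 3 48) (H2ln 7 48))
                  (split (H2pt 25) (H2ln 25 36) (H2ln 25 66) (H2ln 25 102)
                    (clash (H2pt 36) (H2ln 4 32) (H2ln 25 36))
                    (split (H2pt 27) (H2ln 27 47) (H2ln 27 66) (H2ln 27 109)
                      (split (H2pt 43) (H2ln 31 43) (H2ln 43 65) (H2ln 43 94)
                        (clash (H2pt 52) (H2ln 27 47) (H2ln 31 43))
                        (clash (H2pt 65) (H2ln 1 64) (H2ln 43 65))
                        (clash (H2pt 117) (H2ln 5 112) (H2ln 43 94)))
                      (clash (H2pt 66) (H2ln 25 66) (H2ln 27 66))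
                      (clash (H2pt 109) (H2ln 33 76) (H2ln 27 109)))
                    (clash (H2pt 102) (H2ln 6 96) (H2ln 25 102)))
                  (clash (H2pt 96) (H2ln 6 96) (H2ln 7 96)))
                (clash (H2pt 112) (H2ln 5 112) (H2ln 6 112))))
            (clash (H2pt 51) (H2ln 3 48) (H2ln 51 76)))
          (clash (H2pt 48) (H2ln 3 48) (H2ln 4 48)))
        (clash (H2pt 64) (H2ln 1 64) (H2ln 3 64))
        (split (H2pt 6) (H2ln 6 16) (H2ln 6 96) (H2ln 6 112)
          (clash (H2pt 16) (H2ln 2 16) (H2ln 6 16))
          (split (H2pt 78) (H2ln 18 78) (H2ln 47 78) (H2ln 61 78)
            (clash (H2pt 18) (H2ln 2 16) (H2ln 18 78))
            (split (H2pt 4) (H2ln 4 16) (H2ln 4 32) (H2ln 4 48)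
              (clash (H2pt 16) (H2ln 2 16) (H2ln 4 16))
              (split (H2pt 5) (H2ln 5 32) (H2ln 5 80) (H2ln 5 112)
                (clash (H2pt 32) (H2ln 4 32) (H2ln 5 32))
                (split (H2pt 7) (H2ln 7 48) (H2ln 7 80) (H2ln 7 96)
                  (split (H2pt 25) (H2ln 25 36) (H2ln 25 66) (H2ln 25 102)
                    (clash (H2pt 36) (H2ln 4 32) (H2ln 25 36))
                    (split (H2pt 27) (H2ln 27 47) (H2ln 27 66) (H2ln 27 109)
                      (clash (H2pt 47) (H2ln 47 78) (H2ln 27 47))
                      (clash (H2pt 66) (H2ln 25 66) (H2ln 27 66))
                      (split (H2pt 107) (H2ln 29 107) (H2ln 42 65) (H2ln 55 92)
                        (clash (H2pt 118) (H2ln 27 109) (H2ln 29 107))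
                        (clash (H2pt 65) (H2ln 1 64) (H2ln 42 65))
                        (clash (H2pt 55) (H2ln 7 48) (H2ln 55 92))))
                    (clash (H2pt 102) (H2ln 6 96) (H2ln 25 102)))
                  (clash (H2pt 80) (H2ln 5 80) (H2ln 7 80))
                  (clash (H2pt 96) (H2ln 6 96) (H2ln 7 96)))
                (clash (H2pt 112) (H2ln 3 112) (H2ln 5 112)))
              (split (H2pt 7) (H2ln 7 48) (H2ln 7 80) (H2ln 7 96)
                (clash (H2pt 48) (H2ln 4 48) (H2ln 7 48))
                (split (H2pt 5) (H2ln 5 32) (H2ln 5 80) (H2ln 5 112)
                  (split (H2pt 31) (H2ln 31 43) (H2ln 31 77) (H2ln 31 102)
                    (clash (H2pt 52) (H2ln 4 48) (H2ln 31 43))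
                    (split (H2pt 33) (H2ln 1 32) (H2ln 33 76) (H2ln 33 77)
                      (clash (H2pt 32) (H2ln 5 32) (H2ln 1 32))
                      (split (H2pt 27) (H2ln 27 47) (H2ln 27 66) (H2ln 27 109)
                        (clash (H2pt 52) (H2ln 4 48) (H2ln 27 47))
                        (split (H2pt 25) (H2ln 25 36) (H2ln 25 66) (H2ln 25 102)
                          (split (H2pt 29) (H2ln 29 36) (H2ln 29 79) (H2ln 29 107)
                            (clash (H2pt 36) (H2ln 25 36) (H2ln 29 36))
                            (clash (H2pt 82) (H2ln 31 77) (H2ln 29 79))
                            (split (H2pt 92) (H2ln 18 78) (H2ln 37 92) (H2ln 55 92)
                              (clash (H2pt 78) (H2ln 47 78) (H2ln 18 78))
                              (clash (H2pt 37) (H2ln 5 32) (H2ln 37 92))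
                              (clash (H2pt 107) (H2ln 29 107) (H2ln 55 92))))
                          (clash (H2pt 66) (H2ln 27 66) (H2ln 25 66))
                          (clash (H2pt 102) (H2ln 6 96) (H2ln 25 102)))
                        (clash (H2pt 109) (H2ln 33 76) (H2ln 27 109)))
                      (clash (H2pt 77) (H2ln 31 77) (H2ln 33 77)))
                    (clash (H2pt 102) (H2ln 6 96) (H2ln 31 102)))
                  (clash (H2pt 80) (H2ln 7 80) (H2ln 5 80))
                  (clash (H2pt 112) (H2ln 3 112) (H2ln 5 112)))
                (clash (H2pt 96) (H2ln 6 96) (H2ln 7 96))))
            (clash (H2pt 115) (H2ln 3 112) (H2ln 61 78)))
          (clash (H2pt 112) (H2ln 3 112) (H2ln 6 112))))
      (clash (H2pt 64) (H2ln 1 64) (H2ln 2 64))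
      (split (H2pt 3) (H2ln 3 48) (H2ln 3 64) (H2ln 3 112)
        (split (H2pt 7) (H2ln 7 48) (H2ln 7 80) (H2ln 7 96)
          (clash (H2pt 48) (H2ln 3 48) (H2ln 7 48))
          (clash (H2pt 80) (H2ln 2 80) (H2ln 7 80))
          (split (H2pt 79) (H2ln 29 79) (H2ln 46 79) (H2ln 51 79)
            (clash (H2pt 82) (H2ln 2 80) (H2ln 29 79))
            (split (H2pt 4) (H2ln 4 16) (H2ln 4 32) (H2ln 4 48)
              (split (H2pt 6) (H2ln 6 16) (H2ln 6 96) (H2ln 6 112)
                (clash (H2pt 16) (H2ln 4 16) (H2ln 6 16))
                (clash (H2pt 96) (H2ln 7 96) (H2ln 6 96))
                (split (H2pt 5) (H2ln 5 32) (H2ln 5 80) (H2ln 5 112)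
                  (split (H2pt 29) (H2ln 29 36) (H2ln 29 79) (H2ln 29 107)
                    (split (H2pt 42) (H2ln 20 42) (H2ln 42 65) (H2ln 42 85)
                      (clash (H2pt 20) (H2ln 4 16) (H2ln 20 42))
                      (clash (H2pt 65) (H2ln 1 64) (H2ln 42 65))
                      (split (H2pt 25) (H2ln 25 36) (H2ln 25 66) (H2ln 25 102)
                        (clash (H2pt 36) (H2ln 29 36) (H2ln 25 36))
                        (split (H2pt 89) (H2ln 27 66) (H2ln 37 89) (H2ln 62 89)
                          (clash (H2pt 66) (H2ln 25 66) (H2ln 27 66))
                          (clash (H2pt 37) (H2ln 5 32) (H2ln 37 89))
                          (clash (H2pt 103) (H2ln 7 96) (H2ln 62 89)))
                        (clash (H2pt 127) (H2ln 42 85) (H2ln 25 102))))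
                    (clash (H2pt 79) (H2ln 46 79) (H2ln 29 79))
                    (clash (H2pt 118) (H2ln 6 112) (H2ln 29 107)))
                  (clash (H2pt 80) (H2ln 2 80) (H2ln 5 80))
                  (clash (H2pt 112) (H2ln 6 112) (H2ln 5 112))))
              (split (H2pt 5) (H2ln 5 32) (H2ln 5 80) (H2ln 5 112)
                (clash (H2pt 32) (H2ln 4 32) (H2ln 5 32))
                (clash (H2pt 80) (H2ln 2 80) (H2ln 5 80))
                (split (H2pt 6) (H2ln 6 16) (H2ln 6 96) (H2ln 6 112)
                  (split (H2pt 20) (H2ln 4 16) (H2ln 20 42) (H2ln 20 46)
                    (clash (H2pt 16) (H2ln 6 16) (H2ln 4 16))
                    (split (H2pt 29) (H2ln 29 36) (H2ln 29 79) (H2ln 29 107)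
                      (clash (H2pt 36) (H2ln 4 32) (H2ln 29 36))
                      (clash (H2pt 79) (H2ln 46 79) (H2ln 29 79))
                      (split (H2pt 43) (H2ln 31 43) (H2ln 43 65) (H2ln 43 94)
                        (split (H2pt 27) (H2ln 27 47) (H2ln 27 66) (H2ln 27 109)
                          (clash (H2pt 52) (H2ln 31 43) (H2ln 27 47))
                          (split (H2pt 124) (H2ln 22 106) (H2ln 37 89) (H2ln 51 79)
                            (clash (H2pt 22) (H2ln 6 16) (H2ln 22 106))
                            (clash (H2pt 89) (H2ln 27 66) (H2ln 37 89))
                            (clash (H2pt 79) (H2ln 46 79) (H2ln 51 79)))
                          (clash (H2pt 118) (H2ln 29 107) (H2ln 27 109)))
                        (clash (H2pt 65) (H2ln 1 64) (H2ln 43 65))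
                        (clash (H2pt 117) (H2ln 5 112) (H2ln 43 94))))
                    (clash (H2pt 46) (H2ln 46 79) (H2ln 20 46)))
                  (clash (H2pt 96) (H2ln 7 96) (H2ln 6 96))
                  (clash (H2pt 112) (H2ln 5 112) (H2ln 6 112))))
              (clash (H2pt 48) (H2ln 3 48) (H2ln 4 48)))
            (clash (H2pt 51) (H2ln 3 48) (H2ln 51 79))))
        (clash (H2pt 64) (H2ln 1 64) (H2ln 3 64))
        (split (H2pt 5) (H2ln 5 32) (H2ln 5 80) (H2ln 5 112)
          (split (H2pt 77) (H2ln 31 77) (H2ln 33 77) (H2ln 62 77)
            (clash (H2pt 82) (H2ln 2 80) (H2ln 31 77))
            (split (H2pt 4) (H2ln 4 16) (H2ln 4 32) (H2ln 4 48)
              (split (H2pt 6) (H2ln 6 16) (H2ln 6 96) (H2ln 6 112)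
                (clash (H2pt 16) (H2ln 4 16) (H2ln 6 16))
                (split (H2pt 7) (H2ln 7 48) (H2ln 7 80) (H2ln 7 96)
                  (split (H2pt 22) (H2ln 6 16) (H2ln 22 106) (H2ln 22 108)
                    (clash (H2pt 6) (H2ln 6 96) (H2ln 6 16))
                    (split (H2pt 31) (H2ln 31 43) (H2ln 31 77) (H2ln 31 102)
                      (split (H2pt 42) (H2ln 20 42) (H2ln 42 65) (H2ln 42 85)
                        (clash (H2pt 20) (H2ln 4 16) (H2ln 20 42))
                        (clash (H2pt 65) (H2ln 1 64) (H2ln 42 65))
                        (split (H2pt 51) (H2ln 3 48) (H2ln 51 76) (H2ln 51 79)
                          (clash (H2pt 48) (H2ln 7 48) (H2ln 3 48))
                          (clash (H2pt 127) (H2ln 42 85) (H2ln 51 76))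
                          (clash (H2pt 124) (H2ln 22 106) (H2ln 51 79))))
                      (clash (H2pt 77) (H2ln 33 77) (H2ln 31 77))
                      (clash (H2pt 102) (H2ln 6 96) (H2ln 31 102)))
                    (clash (H2pt 108) (H2ln 33 77) (H2ln 22 108)))
                  (clash (H2pt 80) (H2ln 2 80) (H2ln 7 80))
                  (clash (H2pt 96) (H2ln 6 96) (H2ln 7 96)))
                (clash (H2pt 112) (H2ln 3 112) (H2ln 6 112)))
              (clash (H2pt 32) (H2ln 5 32) (H2ln 4 32))
              (split (H2pt 7) (H2ln 7 48) (H2ln 7 80) (H2ln 7 96)
                (clash (H2pt 48) (H2ln 4 48) (H2ln 7 48))
                (clash (H2pt 80) (H2ln 2 80) (H2ln 7 80))
                (split (H2pt 6) (H2ln 6 16) (H2ln 6 96) (H2ln 6 112)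
                  (split (H2pt 31) (H2ln 31 43) (H2ln 31 77) (H2ln 31 102)
                    (clash (H2pt 52) (H2ln 4 48) (H2ln 31 43))
                    (clash (H2pt 77) (H2ln 33 77) (H2ln 31 77))
                    (split (H2pt 43) (H2ln 31 43) (H2ln 43 65) (H2ln 43 94)
                      (clash (H2pt 31) (H2ln 31 102) (H2ln 31 43))
                      (clash (H2pt 65) (H2ln 1 64) (H2ln 43 65))
                      (split (H2pt 18) (H2ln 2 16) (H2ln 18 76) (H2ln 18 78)
                        (clash (H2pt 16) (H2ln 6 16) (H2ln 2 16))
                        (clash (H2pt 94) (H2ln 43 94) (H2ln 18 76))
                        (split (H2pt 55) (H2ln 7 48) (H2ln 55 91) (H2ln 55 92)
                          (clash (H2pt 7) (H2ln 7 96) (H2ln 7 48))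
                          (clash (H2pt 108) (H2ln 33 77) (H2ln 55 91))
                          (clash (H2pt 92) (H2ln 18 78) (H2ln 55 92))))))
                  (clash (H2pt 96) (H2ln 7 96) (H2ln 6 96))
                  (clash (H2pt 112) (H2ln 3 112) (H2ln 6 112)))))
            (clash (H2pt 115) (H2ln 3 112) (H2ln 62 77)))
          (clash (H2pt 80) (H2ln 2 80) (H2ln 5 80))
          (clash (H2pt 112) (H2ln 3 112) (H2ln 5 112)))))
    (split (H2pt 6) (H2ln 6 16) (H2ln 6 96) (H2ln 6 112)
      (split (H2pt 2) (H2ln 2 16) (H2ln 2 64) (H2ln 2 80)
        (clash (H2pt 16) (H2ln 6 16) (H2ln 2 16))
        (split (H2pt 3) (H2ln 3 48) (H2ln 3 64) (H2ln 3 112)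
          (split (H2pt 4) (H2ln 4 16) (H2ln 4 32) (H2ln 4 48)
            (clash (H2pt 16) (H2ln 6 16) (H2ln 4 16))
            (split (H2pt 7) (H2ln 7 48) (H2ln 7 80) (H2ln 7 96)
              (clash (H2pt 48) (H2ln 3 48) (H2ln 7 48))
              (split (H2pt 5) (H2ln 5 32) (H2ln 5 80) (H2ln 5 112)
                (clash (H2pt 32) (H2ln 4 32) (H2ln 5 32))
                (clash (H2pt 80) (H2ln 7 80) (H2ln 5 80))
                (split (H2pt 25) (H2ln 25 36) (H2ln 25 66) (H2ln 25 102)
                  (clash (H2pt 36) (H2ln 4 32) (H2ln 25 36))
                  (clash (H2pt 66) (H2ln 2 64) (H2ln 25 66))
                  (split (H2pt 46) (H2ln 20 46) (H2ln 46 79) (H2ln 46 91)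
                    (split (H2pt 42) (H2ln 20 42) (H2ln 42 65) (H2ln 42 85)
                      (clash (H2pt 20) (H2ln 20 46) (H2ln 20 42))
                      (split (H2pt 106) (H2ln 22 106) (H2ln 43 65) (H2ln 61 87)
                        (clash (H2pt 22) (H2ln 6 16) (H2ln 22 106))
                        (clash (H2pt 65) (H2ln 42 65) (H2ln 43 65))
                        (clash (H2pt 87) (H2ln 7 80) (H2ln 61 87)))
                      (clash (H2pt 127) (H2ln 25 102) (H2ln 42 85)))
                    (clash (H2pt 97) (H2ln 1 96) (H2ln 46 79))
                    (clash (H2pt 117) (H2ln 5 112) (H2ln 46 91)))))
              (clash (H2pt 96) (H2ln 1 96) (H2ln 7 96)))
            (clash (H2pt 48) (H2ln 3 48) (H2ln 4 48)))
          (clash (H2pt 64) (H2ln 2 64) (H2ln 3 64))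
          (split (H2pt 78) (H2ln 18 78) (H2ln 47 78) (H2ln 61 78)
            (split (H2pt 4) (H2ln 4 16) (H2ln 4 32) (H2ln 4 48)
              (clash (H2pt 16) (H2ln 6 16) (H2ln 4 16))
              (split (H2pt 5) (H2ln 5 32) (H2ln 5 80) (H2ln 5 112)
                (clash (H2pt 32) (H2ln 4 32) (H2ln 5 32))
                (split (H2pt 7) (H2ln 7 48) (H2ln 7 80) (H2ln 7 96)
                  (split (H2pt 25) (H2ln 25 36) (H2ln 25 66) (H2ln 25 102)
                    (clash (H2pt 36) (H2ln 4 32) (H2ln 25 36))
                    (clash (H2pt 66) (H2ln 2 64) (H2ln 25 66))
                    (split (H2pt 37) (H2ln 5 32) (H2ln 37 89) (H2ln 37 92)
                      (clash (H2pt 5) (H2ln 5 80) (H2ln 5 32))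
                      (split (H2pt 51) (H2ln 3 48) (H2ln 51 76) (H2ln 51 79)
                        (clash (H2pt 48) (H2ln 7 48) (H2ln 3 48))
                        (clash (H2pt 127) (H2ln 25 102) (H2ln 51 76))
                        (clash (H2pt 124) (H2ln 37 89) (H2ln 51 79)))
                      (clash (H2pt 92) (H2ln 18 78) (H2ln 37 92))))
                  (clash (H2pt 80) (H2ln 5 80) (H2ln 7 80))
                  (clash (H2pt 96) (H2ln 1 96) (H2ln 7 96)))
                (clash (H2pt 112) (H2ln 3 112) (H2ln 5 112)))
              (split (H2pt 7) (H2ln 7 48) (H2ln 7 80) (H2ln 7 96)
                (clash (H2pt 48) (H2ln 4 48) (H2ln 7 48))
                (split (H2pt 5) (H2ln 5 32) (H2ln 5 80) (H2ln 5 112)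
                  (split (H2pt 27) (H2ln 27 47) (H2ln 27 66) (H2ln 27 109)
                    (clash (H2pt 52) (H2ln 4 48) (H2ln 27 47))
                    (clash (H2pt 66) (H2ln 2 64) (H2ln 27 66))
                    (split (H2pt 33) (H2ln 1 32) (H2ln 33 76) (H2ln 33 77)
                      (clash (H2pt 32) (H2ln 5 32) (H2ln 1 32))
                      (clash (H2pt 109) (H2ln 27 109) (H2ln 33 76))
                      (split (H2pt 55) (H2ln 7 48) (H2ln 55 91) (H2ln 55 92)
                        (clash (H2pt 7) (H2ln 7 80) (H2ln 7 48))
                        (clash (H2pt 108) (H2ln 33 77) (H2ln 55 91))
                        (clash (H2pt 92) (H2ln 18 78) (H2ln 55 92)))))
                  (clash (H2pt 80) (H2ln 7 80) (H2ln 5 80))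
                  (clash (H2pt 112) (H2ln 3 112) (H2ln 5 112)))
                (clash (H2pt 96) (H2ln 1 96) (H2ln 7 96))))
            (clash (H2pt 97) (H2ln 1 96) (H2ln 47 78))
            (clash (H2pt 115) (H2ln 3 112) (H2ln 61 78))))
        (split (H2pt 7) (H2ln 7 48) (H2ln 7 80) (H2ln 7 96)
          (split (H2pt 4) (H2ln 4 16) (H2ln 4 32) (H2ln 4 48)
            (clash (H2pt 16) (H2ln 6 16) (H2ln 4 16))
            (split (H2pt 5) (H2ln 5 32) (H2ln 5 80) (H2ln 5 112)
              (clash (H2pt 32) (H2ln 4 32) (H2ln 5 32))
              (clash (H2pt 80) (H2ln 2 80) (H2ln 5 80))
              (split (H2pt 3) (H2ln 3 48) (H2ln 3 64) (H2ln 3 112)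
                (clash (H2pt 48) (H2ln 7 48) (H2ln 3 48))
                (split (H2pt 29) (H2ln 29 36) (H2ln 29 79) (H2ln 29 107)
                  (clash (H2pt 36) (H2ln 4 32) (H2ln 29 36))
                  (clash (H2pt 82) (H2ln 2 80) (H2ln 29 79))
                  (split (H2pt 46) (H2ln 20 46) (H2ln 46 79) (H2ln 46 91)
                    (split (H2pt 42) (H2ln 20 42) (H2ln 42 65) (H2ln 42 85)
                      (clash (H2pt 20) (H2ln 20 46) (H2ln 20 42))
                      (clash (H2pt 107) (H2ln 29 107) (H2ln 42 65))
                      (split (H2pt 122) (H2ln 22 108) (H2ln 47 85) (H2ln 57 67)
                        (clash (H2pt 22) (H2ln 6 16) (H2ln 22 108))
                        (clash (H2pt 85) (H2ln 42 85) (H2ln 47 85))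
                        (clash (H2pt 67) (H2ln 3 64) (H2ln 57 67))))
                    (clash (H2pt 97) (H2ln 1 96) (H2ln 46 79))
                    (clash (H2pt 117) (H2ln 5 112) (H2ln 46 91))))
                (clash (H2pt 112) (H2ln 5 112) (H2ln 3 112))))
            (clash (H2pt 48) (H2ln 7 48) (H2ln 4 48)))
          (clash (H2pt 80) (H2ln 2 80) (H2ln 7 80))
          (clash (H2pt 96) (H2ln 1 96) (H2ln 7 96))))
      (clash (H2pt 96) (H2ln 1 96) (H2ln 6 96))
      (split (H2pt 3) (H2ln 3 48) (H2ln 3 64) (H2ln 3 112)
        (split (H2pt 7) (H2ln 7 48) (H2ln 7 80) (H2ln 7 96)
          (clash (H2pt 48) (H2ln 3 48) (H2ln 7 48))
          (split (H2pt 5) (H2ln 5 32) (H2ln 5 80) (H2ln 5 112)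
            (split (H2pt 4) (H2ln 4 16) (H2ln 4 32) (H2ln 4 48)
              (split (H2pt 2) (H2ln 2 16) (H2ln 2 64) (H2ln 2 80)
                (clash (H2pt 16) (H2ln 4 16) (H2ln 2 16))
                (split (H2pt 27) (H2ln 27 47) (H2ln 27 66) (H2ln 27 109)
                  (split (H2pt 46) (H2ln 20 46) (H2ln 46 79) (H2ln 46 91)
                    (clash (H2pt 20) (H2ln 4 16) (H2ln 20 46))
                    (clash (H2pt 97) (H2ln 1 96) (H2ln 46 79))
                    (split (H2pt 43) (H2ln 31 43) (H2ln 43 65) (H2ln 43 94)
                      (clash (H2pt 52) (H2ln 27 47) (H2ln 31 43))
                      (split (H2pt 124) (H2ln 22 106) (H2ln 37 89) (H2ln 51 79)
                        (clash (H2pt 106) (H2ln 43 65) (H2ln 22 106))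
                        (clash (H2pt 37) (H2ln 5 32) (H2ln 37 89))
                        (clash (H2pt 51) (H2ln 3 48) (H2ln 51 79)))
                      (clash (H2pt 117) (H2ln 46 91) (H2ln 43 94))))
                  (clash (H2pt 66) (H2ln 2 64) (H2ln 27 66))
                  (clash (H2pt 118) (H2ln 6 112) (H2ln 27 109)))
                (clash (H2pt 80) (H2ln 7 80) (H2ln 2 80)))
              (clash (H2pt 32) (H2ln 5 32) (H2ln 4 32))
              (clash (H2pt 48) (H2ln 3 48) (H2ln 4 48)))
            (clash (H2pt 80) (H2ln 7 80) (H2ln 5 80))
            (clash (H2pt 112) (H2ln 6 112) (H2ln 5 112)))
          (clash (H2pt 96) (H2ln 1 96) (H2ln 7 96)))
        (split (H2pt 2) (H2ln 2 16) (H2ln 2 64) (H2ln 2 80)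
          (split (H2pt 78) (H2ln 18 78) (H2ln 47 78) (H2ln 61 78)
            (clash (H2pt 18) (H2ln 2 16) (H2ln 18 78))
            (clash (H2pt 97) (H2ln 1 96) (H2ln 47 78))
            (split (H2pt 4) (H2ln 4 16) (H2ln 4 32) (H2ln 4 48)
              (clash (H2pt 16) (H2ln 2 16) (H2ln 4 16))
              (split (H2pt 5) (H2ln 5 32) (H2ln 5 80) (H2ln 5 112)
                (clash (H2pt 32) (H2ln 4 32) (H2ln 5 32))
                (split (H2pt 7) (H2ln 7 48) (H2ln 7 80) (H2ln 7 96)
                  (split (H2pt 29) (H2ln 29 36) (H2ln 29 79) (H2ln 29 107)
                    (clash (H2pt 36) (H2ln 4 32) (H2ln 29 36))
                    (split (H2pt 47) (H2ln 27 47) (H2ln 47 78) (H2ln 47 85)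
                      (split (H2pt 31) (H2ln 31 43) (H2ln 31 77) (H2ln 31 102)
                        (clash (H2pt 52) (H2ln 27 47) (H2ln 31 43))
                        (clash (H2pt 82) (H2ln 29 79) (H2ln 31 77))
                        (split (H2pt 92) (H2ln 18 78) (H2ln 37 92) (H2ln 55 92)
                          (clash (H2pt 78) (H2ln 61 78) (H2ln 18 78))
                          (clash (H2pt 121) (H2ln 31 102) (H2ln 37 92))
                          (clash (H2pt 55) (H2ln 7 48) (H2ln 55 92))))
                      (clash (H2pt 78) (H2ln 61 78) (H2ln 47 78))
                      (clash (H2pt 85) (H2ln 5 80) (H2ln 47 85)))
                    (clash (H2pt 118) (H2ln 6 112) (H2ln 29 107)))
                  (clash (H2pt 80) (H2ln 5 80) (H2ln 7 80))
                  (clash (H2pt 96) (H2ln 1 96) (H2ln 7 96)))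
                (clash (H2pt 112) (H2ln 6 112) (H2ln 5 112)))
              (split (H2pt 7) (H2ln 7 48) (H2ln 7 80) (H2ln 7 96)
                (clash (H2pt 48) (H2ln 4 48) (H2ln 7 48))
                (split (H2pt 5) (H2ln 5 32) (H2ln 5 80) (H2ln 5 112)
                  (split (H2pt 27) (H2ln 27 47) (H2ln 27 66) (H2ln 27 109)
                    (clash (H2pt 52) (H2ln 4 48) (H2ln 27 47))
                    (split (H2pt 25) (H2ln 25 36) (H2ln 25 66) (H2ln 25 102)
                      (clash (H2pt 61) (H2ln 61 78) (H2ln 25 36))
                      (clash (H2pt 66) (H2ln 27 66) (H2ln 25 66))
                      (split (H2pt 121) (H2ln 31 102) (H2ln 37 92) (H2ln 58 67)
                        (clash (H2pt 102) (H2ln 25 102) (H2ln 31 102))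
                        (clash (H2pt 37) (H2ln 5 32) (H2ln 37 92))
                        (clash (H2pt 67) (H2ln 3 64) (H2ln 58 67))))
                    (clash (H2pt 118) (H2ln 6 112) (H2ln 27 109)))
                  (clash (H2pt 80) (H2ln 7 80) (H2ln 5 80))
                  (clash (H2pt 112) (H2ln 6 112) (H2ln 5 112)))
                (clash (H2pt 96) (H2ln 1 96) (H2ln 7 96)))))
          (clash (H2pt 64) (H2ln 3 64) (H2ln 2 64))
          (split (H2pt 5) (H2ln 5 32) (H2ln 5 80) (H2ln 5 112)
            (split (H2pt 7) (H2ln 7 48) (H2ln 7 80) (H2ln 7 96)
              (split (H2pt 4) (H2ln 4 16) (H2ln 4 32) (H2ln 4 48)
                (split (H2pt 29) (H2ln 29 36) (H2ln 29 79) (H2ln 29 107)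
                  (split (H2pt 46) (H2ln 20 46) (H2ln 46 79) (H2ln 46 91)
                    (clash (H2pt 20) (H2ln 4 16) (H2ln 20 46))
                    (clash (H2pt 97) (H2ln 1 96) (H2ln 46 79))
                    (split (H2pt 25) (H2ln 25 36) (H2ln 25 66) (H2ln 25 102)
                      (clash (H2pt 36) (H2ln 29 36) (H2ln 25 36))
                      (clash (H2pt 91) (H2ln 46 91) (H2ln 25 66))
                      (split (H2pt 121) (H2ln 31 102) (H2ln 37 92) (H2ln 58 67)
                        (clash (H2pt 102) (H2ln 25 102) (H2ln 31 102))
                        (clash (H2pt 37) (H2ln 5 32) (H2ln 37 92))
                        (clash (H2pt 67) (H2ln 3 64) (H2ln 58 67)))))
                  (clash (H2pt 82) (H2ln 2 80) (H2ln 29 79))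
                  (clash (H2pt 118) (H2ln 6 112) (H2ln 29 107)))
                (clash (H2pt 32) (H2ln 5 32) (H2ln 4 32))
                (clash (H2pt 48) (H2ln 7 48) (H2ln 4 48)))
              (clash (H2pt 80) (H2ln 2 80) (H2ln 7 80))
              (clash (H2pt 96) (H2ln 1 96) (H2ln 7 96)))
            (clash (H2pt 80) (H2ln 2 80) (H2ln 5 80))
            (clash (H2pt 112) (H2ln 6 112) (H2ln 5 112))))
        (clash (H2pt 112) (H2ln 6 112) (H2ln 3 112))))

HD2-noDistance2Ovoid : ∀ {a} {O : H2Line → Set a} → ¬ IsDistance2Ovoid HD2 O
HD2-noDistance2Ovoid ovoid =
  Valid⇒¬Distance2Ovoid ovoid certificate (toWitness {a? = valid? [] certificate} _) []

corollary3p7 : ∀ {ℓ} (S : Geometry ℓ) →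
    ¬ (GeometryNotions.IsSemiFiniteHexagonOrder2t S × FullEmbedding HD2 S)
corollary3p7 S ((hexagon , three , infinite) , E) =
  ¬image-covers infinite H2Line↣Fin pt (near-image⇒image infinite H2Line↣Fin pt near-image)
  where
  open WalkProperties S
  open GeneralizedHexagonProperties hexagon
  open FullEmbeddingProperties hexagon three E
  open FullEmbedding E using (pt)
  near-image : ∀ w → ¬ ¬ (∃[ h ] Near w (pt h))
  near-image w far = HD2-noDistance2Ovoid (far⇒distance2Ovoid far)
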